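{- The closure ordinals of the immediate derivability operators $\underline{\mathscr{D}}^-$ (of $!\underline{\mathbf{ACT}}_\omega^-$) and $\mathscr{D}^-$ (of $!\mathbf{ACT}_\omega^-$) are both less than or equal to $\omega^\omega$.
   Context: Formulas are built from a countable set of variables and constants $0,1$ using binary $\backslash$, $/$, $\cdot$, $\oplus$, $\&$, unary postfix ${}^*$ and unary prefix $!$. A sequent is $\Pi\Rightarrow B$ ($\Pi$ a finite, possibly empty, sequence of formulas); $A^n$ is $n$ copies of $A$; $!\Pi$ is a sequence of formulas of the form $!A$. The cut-free calculus for infinitary action logic with exponentiation has axioms $A\Rightarrow A$, $\ \Rightarrow1$, $\ \Gamma,0,\Delta\Rightarrow C$, $\ \Rightarrow A^*$ and rules (premises / conclusion): ($\backslash L$) $\Pi\Rightarrow A$, $\Gamma,B,\Delta\Rightarrow C$ / $\Gamma,\Pi,A\backslash B,\Delta\Rightarrow C$; ($\backslash R$) $A,\Pi\Rightarrow B$ / $\Pi\Rightarrow A\backslash B$; ($/L$) $\Pi\Rightarrow A$, $\Gamma,B,\Delta\Rightarrow C$ / $\Gamma,B/A,\Pi,\Delta\Rightarrow C$; ($/R$) $\Pi,A\Rightarrow B$ / $\Pi\Rightarrow B/A$; ($\cdot L$) $\Gamma,A,B,\Delta\Rightarrow C$ / $\Gamma,A\cdot B,\Delta\Rightarrow C$; ($\cdot R$) $\Gamma\Rightarrow A$, $\Delta\Rightarrow B$ / $\Gamma,\Delta\Rightarrow A\cdot B$; ($1L$) $\Gamma,\Delta\Rightarrow C$ / $\Gamma,1,\Delta\Rightarrow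 C$; ($\oplus L$) $\Gamma,A_1,\Delta\Rightarrow C$, $\Gamma,A_2,\Delta\Rightarrow C$ / $\Gamma,A_1\oplus A_2,\Delta\Rightarrow C$; ($\oplus R_i$) $\Pi\Rightarrow A_i$ / $\Pi\Rightarrow A_1\oplus A_2$; ($\&L_i$) $\Gamma,A_i,\Delta\Rightarrow C$ / $\Gamma,A_1\&A_2,\Delta\Rightarrow C$; ($\&R$) $\Pi\Rightarrow A_1$, $\Pi\Rightarrow A_2$ / $\Pi\Rightarrow A_1\&A_2$; (${}^*L_\omega$) $(\Gamma,A^n,\Delta\Rightarrow C)_{n\in\omega}$ / $\Gamma,A^*,\Delta\Rightarrow C$; (${}^*R_n$, $n\ge1$) $\Pi_1\Rightarrow A,\dots,\Pi_n\Rightarrow A$ / $\Pi_1,\dots,\Pi_n\Rightarrow A^*$; ($!L$) $\Gamma,A,\Delta\Rightarrow C$ / $\Gamma,!A,\Delta\Rightarrow C$; ($!R$) $!\Pi\Rightarrow B$ / $!\Pi\Rightarrow!B$; ($!P_1$) $\Gamma,\Pi,!A,\Delta\Rightarrow C$ / $\Gamma,!A,\Pi,\Delta\Rightarrow C$; ($!P_2$) $\Gamma,!A,\Pi,\Delta\Rightarrow C$ / $\Gamma,\Pi,!A,\Delta\Rightarrow C$; ($!W$) $\Gamma,\Delta\Rightarrow C$ / $\Gamma,!A,\Delta\Rightarrow C$; ($!C$) $\Gamma,!A,!A,\Delta\Rightarrow C$ / $\Gamma,!A,\Delta\Rightarrow C$. The calculus $!\mathbf{ACT}_\omega^-$ is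 this calculus restricted to sequents in which every subformula $!B$ has $B$ free of ${}^*$. The calculus $!\underline{\mathbf{ACT}}_\omega^-$ (on the same sequents) has exactly two rules: the rule (${}^*L_\omega$) and the rule (Fin), by which $s$ may be inferred from $s_1,\dots,s_m$ ($m\ge0$) iff $s$ is derivable from $s_1,\dots,s_m$ in $!\mathbf{ACT}_\omega^-$ without using (${}^*L_\omega$). The immediate derivability operator $\mathscr{D}_{\mathbf L}$ of a calculus $\mathbf L$ maps a set $S$ of sequents to the set of sequents that belong to $S$ or are obtained from members of $S$ by one application of a rule of $\mathbf L$ (axioms count as rules without premises); $\mathscr{D}^-$ and $\underline{\mathscr{D}}^-$ denote these operators for $!\mathbf{ACT}_\omega^-$ and $!\underline{\mathbf{ACT}}_\omega^-$. For a monotone operator $F$ on sets, $F^0(S)=S$, $F^{\alpha+1}(S)=F(F^\alpha(S))$, $F^\lambda(S)=\bigcup_{\beta<\lambda}F^\beta(S)$ for nonzero limit $\lambda$; the closure ordinal of $F$ is the least ordinal $\alpha$ with $F^{\alpha+1}(\varnothing)=F^\alpha(\varnothing)$. -}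

module Defs where

open import Data.Nat using (ℕ; zero; suc)
open import Data.List using (List; []; _∷_; _++_; [_]; map; concat; replicate)
open import Data.List.Relation.Unary.All using (All)
open import Data.List.Membership.Propositional using (_∈_)
open import Data.Product using (Σ; _×_; _,_)
open import Data.Sum using (_⊎_)
open import Data.Unit using (⊤)
open import Data.Empty using (⊥)

infixr 30 _＼_
infixl 30 _／_
infixr 31 _·_
infixr 29 _⊕_ _&_
infixl 40 _⋆
infix 45 !_

data Formula : Set where
  var  : ℕ → Formula
  𝟎 𝟏  : Formula
  _＼_ : Formula → Formula → Formula
  _／_ : Formula → Formula → Formula
  _·_  : Formula → Formula → Formula
  _⊕_  : Formula → Formula → Formula
  _&_  : Formula → Formula → Formula
  _⋆   : Formula → Formula
  !_   : Formula → Formula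

Ctx : Set
Ctx = List Formula

infix 4 _⇒_
record Sequent : Set where
  constructor _⇒_
  field
    ante : Ctx
    succ : Formula

-- The restriction: every subformula !B has B free of ^*

StarFree : Formula → Set
StarFree (var _) = ⊤
StarFree 𝟎 = ⊤
StarFree 𝟏 = ⊤
StarFree (A ＼ B) = StarFree A × StarFree B
StarFree (A ／ B) = StarFree A × StarFree B
StarFree (A · B) = StarFree A × StarFree B
StarFree (A ⊕ B) = StarFree A × StarFree B
StarFree (A & B) = StarFree A × StarFree B
StarFree (A ⋆) = ⊥
StarFree (! A) = StarFree A

GoodF : Formula → Set
GoodF (var _) = ⊤
GoodF 𝟎 = ⊤
GoodF 𝟏 = ⊤
GoodF (A ＼ B) = GoodF A × GoodF B
GoodF (A ／ B) = GoodF A × GoodF B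
GoodF (A · B) = GoodF A × GoodF B
GoodF (A ⊕ B) = GoodF A × GoodF B
GoodF (A & B) = GoodF A × GoodF B
GoodF (A ⋆) = GoodF A
GoodF (! A) = StarFree A

-- (StarFree A implies GoodF A, so GoodF (! A) = StarFree A covers all
--  subformulas of ! A.)

Good : Sequent → Set
Good (Π ⇒ B) = All GoodF Π × GoodF B

SeqSet : Set₁
SeqSet = Sequent → Set

-- One application of a rule of !ACT_ω other than (*L_ω), with premises in R.
-- Axioms are rules without premises.

data Step (R : SeqSet) : SeqSet where
  ax     : ∀ {A} → Step R ([ A ] ⇒ A)
  oneR   : Step R ([] ⇒ 𝟏)
  zeroL  : ∀ {Γ Δ C} → Step R (Γ ++ 𝟎 ∷ Δ ⇒ C)
  starAx : ∀ {A} → Step R ([] ⇒ A ⋆)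
  ＼L    : ∀ {Π Γ Δ A B C} → R (Π ⇒ A) → R (Γ ++ B ∷ Δ ⇒ C) →
           Step R (Γ ++ Π ++ (A ＼ B) ∷ Δ ⇒ C)
  ＼R    : ∀ {Π A B} → R (A ∷ Π ⇒ B) → Step R (Π ⇒ A ＼ B)
  ／L    : ∀ {Π Γ Δ A B C} → R (Π ⇒ A) → R (Γ ++ B ∷ Δ ⇒ C) →
           Step R (Γ ++ (B ／ A) ∷ Π ++ Δ ⇒ C)
  ／R    : ∀ {Π A B} → R (Π ++ [ A ] ⇒ B) → Step R (Π ⇒ B ／ A)
  ·L     : ∀ {Γ Δ A B C} → R (Γ ++ A ∷ B ∷ Δ ⇒ C) → Step R (Γ ++ (A · B) ∷ Δ ⇒ C)
  ·R     : ∀ {Γ Δ A B} → R (Γ ⇒ A) → R (Δ ⇒ B) → Step R (Γ ++ Δ ⇒ A · B)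
  1L     : ∀ {Γ Δ C} → R (Γ ++ Δ ⇒ C) → Step R (Γ ++ 𝟏 ∷ Δ ⇒ C)
  ⊕L     : ∀ {Γ Δ A₁ A₂ C} → R (Γ ++ A₁ ∷ Δ ⇒ C) → R (Γ ++ A₂ ∷ Δ ⇒ C) →
           Step R (Γ ++ (A₁ ⊕ A₂) ∷ Δ ⇒ C)
  ⊕R₁    : ∀ {Π A₁ A₂} → R (Π ⇒ A₁) → Step R (Π ⇒ A₁ ⊕ A₂)
  ⊕R₂    : ∀ {Π A₁ A₂} → R (Π ⇒ A₂) → Step R (Π ⇒ A₁ ⊕ A₂)
  &L₁    : ∀ {Γ Δ A₁ A₂ C} → R (Γ ++ A₁ ∷ Δ ⇒ C) → Step R (Γ ++ (A₁ & A₂) ∷ Δ ⇒ C)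
  &L₂    : ∀ {Γ Δ A₁ A₂ C} → R (Γ ++ A₂ ∷ Δ ⇒ C) → Step R (Γ ++ (A₁ & A₂) ∷ Δ ⇒ C)
  &R     : ∀ {Π A₁ A₂} → R (Π ⇒ A₁) → R (Π ⇒ A₂) → Step R (Π ⇒ A₁ & A₂)
  -- (*R_n), n ≥ 1: premises Π₁ ⇒ A, …, Πₙ ⇒ A (the list Π ∷ Πs, nonempty)
  ⋆R     : ∀ {A} (Π : Ctx) (Πs : List Ctx) →
           (∀ {Π'} → Π' ∈ (Π ∷ Πs) → R (Π' ⇒ A)) →
           Step R (concat (Π ∷ Πs) ⇒ A ⋆)
  !L     : ∀ {Γ Δ A C} → R (Γ ++ A ∷ Δ ⇒ C) → Step R (Γ ++ (! A) ∷ Δ ⇒ C)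
  !R     : ∀ {B} (Π : Ctx) → R (map !_ Π ⇒ B) → Step R (map !_ Π ⇒ ! B)
  !P₁    : ∀ {Γ Π Δ A C} → R (Γ ++ Π ++ (! A) ∷ Δ ⇒ C) → Step R (Γ ++ (! A) ∷ Π ++ Δ ⇒ C)
  !P₂    : ∀ {Γ Π Δ A C} → R (Γ ++ (! A) ∷ Π ++ Δ ⇒ C) → Step R (Γ ++ Π ++ (! A) ∷ Δ ⇒ C)
  !W     : ∀ {Γ Δ A C} → R (Γ ++ Δ ⇒ C) → Step R (Γ ++ (! A) ∷ Δ ⇒ C)
  !C     : ∀ {Γ Δ A C} → R (Γ ++ (! A) ∷ (! A) ∷ Δ ⇒ C) → Step R (Γ ++ (! A) ∷ Δ ⇒ C)

data StarL (R : SeqSet) : SeqSet where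
  ⋆Lω : ∀ {Γ Δ A C} → (∀ n → R (Γ ++ replicate n A ++ Δ ⇒ C)) →
        StarL R (Γ ++ (A ⋆) ∷ Δ ⇒ C)

data DerivFrom (H : List Sequent) : SeqSet where
  hyp  : ∀ {s} → s ∈ H → DerivFrom H s
  step : ∀ {s} → Good s → Step (DerivFrom H) s → DerivFrom H s

𝒟⁻ : SeqSet → SeqSet
𝒟⁻ S s = S s ⊎ (Good s × (Step S s ⊎ StarL S s))

-- 𝒟̲⁻ : operator of !ACT̲_ω^- (rules (*L_ω) and (Fin))
𝒟̲⁻ : SeqSet → SeqSet
𝒟̲⁻ S s = S s ⊎ (Good s × (StarL S s ⊎ Σ (List Sequent) (λ H → All S H × DerivFrom H s)))

data Ord : Set where
  oz   : Ord
  os   : Ord → Ord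
  olim : (ℕ → Ord) → Ord

_+o_ : Ord → Ord → Ord
a +o oz = a
a +o os b = os (a +o b)
a +o olim f = olim (λ n → a +o f n)

_×n_ : Ord → ℕ → Ord
a ×n zero = oz
a ×n suc n = (a ×n n) +o a

ω^_ : ℕ → Ord
ω^ zero = os oz
ω^ suc k = olim (λ n → (ω^ k) ×n n)

ω^ω : Ord
ω^ω = olim ω^_

-- F^α(∅); at a limit the union is taken along the (increasing, cofinal)
-- fundamental sequence of the code.
iter : (SeqSet → SeqSet) → Ord → SeqSet
iter F oz s = ⊥
iter F (os a) s = F (iter F a) s
iter F (olim f) s = Σ ℕ (λ n → iter F (f n) s)

_≐_ : SeqSet → SeqSet → Set
X ≐ Y = (∀ s → X s → Y s) × (∀ s → Y s → X s)

ClosureOrdinal≤ : (SeqSet → SeqSet) → Ord → Set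
ClosureOrdinal≤ F α = iter F (os α) ≐ iter F α

{-# OPTIONS --safe #-}
module Submission where

-- Let μ s e count the occurrences of star subformulas of star height e in the
-- sequent s, and let rank s = ω^D·μ s (D−1) + … + ω·μ s 0, for D above all star heights in s.
-- No finitary rule increases μ pointwise (contraction only copies !A, and A is star-free),
-- while each premise of (*L_ω) trades one star of height h for several copies of formulas of
-- height < h, so that rank premise + k stays below rank s for every k ∈ ℕ. By induction on α,
-- every sequent s ∈ F^α(∅) has a finite derivation from sequents in F^{rank s + 1}(∅); a finite
-- derivation climbs only finitely many stages, so s ∈ F^{rank s + k}(∅) ⊆ F^{ω^ω}(∅).

open import Defs
open import Data.Bool using (if_then_else_)
open import Data.List using (List; []; _∷_; _++_; [_]; map; concat; replicate; foldr)
open import Data.List.Membership.Propositional using (_∈_)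
open import Data.List.Membership.Propositional.Properties using (∈-++⁺ˡ; ∈-++⁺ʳ)
open import Data.List.Relation.Binary.Permutation.Propositional using (_↭_; prep; ↭-sym)
open import Data.List.Relation.Binary.Permutation.Propositional.Properties as Perm
  using (++⁺ˡ; shift; shifts; ∷↭∷ʳ)
open import Data.List.Relation.Unary.All using (All; []; _∷_)
import Data.List.Relation.Unary.All as All
import Data.List.Relation.Unary.All.Properties as All
open import Data.List.Relation.Unary.Any using (here; there)
open import Data.List.Properties using (map-++)
open import Data.Nat using (ℕ; zero; suc; _+_; _≤_; _<_; _≤′_; ≤′-refl; ≤′-step; _⊔_; _≟_; z≤n)
open import Data.Nat.ListAction using (sum)
open import Data.Nat.ListAction.Properties using (sum-++; sum-↭)
open import Data.Nat.Properties
  using ( +-assoc; +-identityʳ; +-mono-≤; +-monoˡ-≤; m≤m+n; m≤n+m; ≤-refl; ≤-reflexive; ≤-trans; ≤-pred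
        ; <⇒≤; <⇒≢; <-trans; <-≤-trans; n<1+n; ≰⇒>; n≮0; m≤n⇒m<n∨m≡n; ≤⇒≤′; ≤′⇒≤
        ; m≤m⊔n; m≤n⊔m; m⊔n<o⇒m<o; m⊔n<o⇒n<o )
open import Data.Product using (Σ; ∃; _×_; _,_)
open import Data.Sum using (inj₁; inj₂)
open import Function using (id; _∘_)
open import Relation.Binary.PropositionalEquality
  using (_≡_; refl; sym; trans; cong; cong₂; subst; subst₂; module ≡-Reasoning)
open import Relation.Nullary.Decidable using (does; dec-true; dec-false)
open import Relation.Unary using (_⊆_; _∪_; _∩_)

starHeight : Formula → ℕ
starHeight (var _) = 0
starHeight 𝟎 = 0
starHeight 𝟏 = 0
starHeight (A ＼ B) = starHeight A ⊔ starHeight B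
starHeight (A ／ B) = starHeight A ⊔ starHeight B
starHeight (A · B) = starHeight A ⊔ starHeight B
starHeight (A ⊕ B) = starHeight A ⊔ starHeight B
starHeight (A & B) = starHeight A ⊔ starHeight B
starHeight (A ⋆) = suc (starHeight A)
starHeight (! A) = starHeight A

indicator : ℕ → ℕ → ℕ
indicator m n = if does (m ≟ n) then 1 else 0

indicator-refl : ∀ n → indicator n n ≡ 1
indicator-refl n = cong (if_then 1 else 0) (dec-true (n ≟ n) refl)

indicator-< : ∀ {m n} → m < n → indicator m n ≡ 0
indicator-< {m} {n} m<n = cong (if_then 1 else 0) (dec-false (m ≟ n) (<⇒≢ m<n))

-- Occurrences are counted in every position; the summands of both A ＼ B and B ／ A are ordered
-- (B, A), so that the two implications share their measure lemmas.
stars : Formula → ℕ → ℕ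
stars (var _) e = 0
stars 𝟎 e = 0
stars 𝟏 e = 0
stars (A ＼ B) e = stars B e + stars A e
stars (A ／ B) e = stars A e + stars B e
stars (A · B) e = stars A e + stars B e
stars (A ⊕ B) e = stars A e + stars B e
stars (A & B) e = stars A e + stars B e
stars (A ⋆) e = indicator (starHeight (A ⋆)) e + stars A e
stars (! A) e = stars A e

starsCtx : Ctx → ℕ → ℕ
starsCtx Γ e = sum (map (λ A → stars A e) Γ)

formulas : Sequent → Ctx
formulas (Γ ⇒ C) = C ∷ Γ

μ : Sequent → ℕ → ℕ
μ s = starsCtx (formulas s)

infix 3 _≤μ_
_≤μ_ : Sequent → Sequent → Set
t ≤μ s = ∀ e → μ t e ≤ μ s e

maxStarHeight : Ctx → ℕ
maxStarHeight = foldr (λ A n → starHeight A ⊔ n) 0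

heightBound : Sequent → ℕ
heightBound s = suc (maxStarHeight (formulas s))

stars-above : ∀ A {e} → starHeight A < e → stars A e ≡ 0
stars-above (var _) _ = refl
stars-above 𝟎 _ = refl
stars-above 𝟏 _ = refl
stars-above (A ＼ B) h = cong₂ _+_ (stars-above B (m⊔n<o⇒n<o _ _ h)) (stars-above A (m⊔n<o⇒m<o _ _ h))
stars-above (A ／ B) h = cong₂ _+_ (stars-above A (m⊔n<o⇒m<o _ _ h)) (stars-above B (m⊔n<o⇒n<o _ _ h))
stars-above (A · B) h = cong₂ _+_ (stars-above A (m⊔n<o⇒m<o _ _ h)) (stars-above B (m⊔n<o⇒n<o _ _ h))
stars-above (A ⊕ B) h = cong₂ _+_ (stars-above A (m⊔n<o⇒m<o _ _ h)) (stars-above B (m⊔n<o⇒n<o _ _ h))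
stars-above (A & B) h = cong₂ _+_ (stars-above A (m⊔n<o⇒m<o _ _ h)) (stars-above B (m⊔n<o⇒n<o _ _ h))
stars-above (A ⋆) h = cong₂ _+_ (indicator-< h) (stars-above A (<-trans (n<1+n _) h))
stars-above (! A) h = stars-above A h

starsCtx-above : ∀ Γ {e} → maxStarHeight Γ < e → starsCtx Γ e ≡ 0
starsCtx-above [] _ = refl
starsCtx-above (A ∷ Γ) h =
  cong₂ _+_ (stars-above A (m⊔n<o⇒m<o _ _ h)) (starsCtx-above Γ (m⊔n<o⇒n<o _ _ h))

μ-above : ∀ s {e} → heightBound s ≤ e → μ s e ≡ 0
μ-above s = starsCtx-above (formulas s)

stars-StarFree : ∀ A {e} → StarFree A → stars A e ≡ 0
stars-StarFree (var _) _ = refl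
stars-StarFree 𝟎 _ = refl
stars-StarFree 𝟏 _ = refl
stars-StarFree (A ＼ B) (a , b) = cong₂ _+_ (stars-StarFree B b) (stars-StarFree A a)
stars-StarFree (A ／ B) (a , b) = cong₂ _+_ (stars-StarFree A a) (stars-StarFree B b)
stars-StarFree (A · B) (a , b) = cong₂ _+_ (stars-StarFree A a) (stars-StarFree B b)
stars-StarFree (A ⊕ B) (a , b) = cong₂ _+_ (stars-StarFree A a) (stars-StarFree B b)
stars-StarFree (A & B) (a , b) = cong₂ _+_ (stars-StarFree A a) (stars-StarFree B b)
stars-StarFree (! A) a = stars-StarFree A a

starsCtx-++ : ∀ Γ Δ e → starsCtx (Γ ++ Δ) e ≡ starsCtx Γ e + starsCtx Δ e
starsCtx-++ Γ Δ e = trans (cong sum (map-++ _ Γ Δ)) (sum-++ (map (λ A → stars A e) Γ) _)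

starsCtx-↭ : ∀ {Γ Δ} → Γ ↭ Δ → ∀ e → starsCtx Γ e ≡ starsCtx Δ e
starsCtx-↭ p e = sum-↭ (Perm.map⁺ _ p)

starsCtx-middle : ∀ Γ Xs Δ e → starsCtx (Γ ++ Xs ++ Δ) e ≡ starsCtx Xs e + starsCtx (Γ ++ Δ) e
starsCtx-middle Γ Xs Δ e = trans (starsCtx-↭ (shifts Γ Xs) e) (starsCtx-++ Xs (Γ ++ Δ) e)

starsCtx-infix : ∀ Γ Xs Δ e → starsCtx Xs e ≤ starsCtx (Γ ++ Xs ++ Δ) e
starsCtx-infix Γ Xs Δ e = subst (_ ≤_) (sym (starsCtx-middle Γ Xs Δ e)) (m≤m+n _ _)

starsCtx-frame : ∀ Γ {Ys Xs} Δ e → starsCtx Ys e ≤ starsCtx Xs e →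
                 starsCtx (Γ ++ Ys ++ Δ) e ≤ starsCtx (Γ ++ Xs ++ Δ) e
starsCtx-frame Γ {Ys} {Xs} Δ e h =
  subst₂ _≤_ (sym (starsCtx-middle Γ Ys Δ e)) (sym (starsCtx-middle Γ Xs Δ e)) (+-monoˡ-≤ _ h)

starsCtx-concat : ∀ {Π} Πs e → Π ∈ Πs → starsCtx Π e ≤ starsCtx (concat Πs) e
starsCtx-concat (Π ∷ Πs) e (here refl) = starsCtx-infix [] Π (concat Πs) e
starsCtx-concat (Π ∷ Πs) e (there Π∈Πs) =
  subst (_ ≤_) (sym (starsCtx-++ Π (concat Πs) e))
        (≤-trans (starsCtx-concat Πs e Π∈Πs) (m≤n+m _ _))

starsCtx-replicate : ∀ n {A e} → stars A e ≡ 0 → starsCtx (replicate n A) e ≡ 0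
starsCtx-replicate zero _ = refl
starsCtx-replicate (suc n) sA≡0 = cong₂ _+_ sA≡0 (starsCtx-replicate n sA≡0)

record Premises (R : SeqSet) (s : Sequent) : Set₁ where
  field
    list    : List Sequent
    hold    : All R list
    rebuild : ∀ {R'} → All R' list → Step R' s

module _ {R : SeqSet} {s : Sequent} where
  noPremise : (∀ {R'} → Step R' s) → Premises R s
  noPremise r = record { list = [] ; hold = [] ; rebuild = λ _ → r }

  onePremise : ∀ {t} → R t → (∀ {R'} → R' t → Step R' s) → Premises R s
  onePremise d r = record { list = _ ; hold = d ∷ [] ; rebuild = λ { (d' ∷ []) → r d' } }

  twoPremises : ∀ {t u} → R t → R u → (∀ {R'} → R' t → R' u → Step R' s) → Premises R s
  twoPremises d₁ d₂ r =
    record { list = _ ; hold = d₁ ∷ d₂ ∷ [] ; rebuild = λ { (d₁' ∷ d₂' ∷ []) → r d₁' d₂' } }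

premises : ∀ {R s} → Step R s → Premises R s
premises ax = noPremise ax
premises oneR = noPremise oneR
premises zeroL = noPremise zeroL
premises starAx = noPremise starAx
premises (＼L d₁ d₂) = twoPremises d₁ d₂ ＼L
premises (＼R d) = onePremise d ＼R
premises (／L d₁ d₂) = twoPremises d₁ d₂ ／L
premises (／R d) = onePremise d ／R
premises (·L d) = onePremise d ·L
premises (·R d₁ d₂) = twoPremises d₁ d₂ ·R
premises (1L d) = onePremise d 1L
premises (⊕L d₁ d₂) = twoPremises d₁ d₂ ⊕L
premises (⊕R₁ d) = onePremise d ⊕R₁
premises (⊕R₂ d) = onePremise d ⊕R₂
premises (&L₁ d) = onePremise d &L₁
premises (&L₂ d) = onePremise d &L₂
premises (&R d₁ d₂) = twoPremises d₁ d₂ &R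
premises (⋆R {A} Π Πs ds) = record
  { list = map (_⇒ A) (Π ∷ Πs)
  ; hold = All.map⁺ (All.tabulate ds)
  ; rebuild = λ ds' → ⋆R Π Πs (All.lookup (All.map⁻ ds'))
  }
premises (!L d) = onePremise d !L
premises (!R Π d) = onePremise d (!R Π)
premises (!P₁ d) = onePremise d !P₁
premises (!P₂ d) = onePremise d !P₂
premises (!W d) = onePremise d !W
premises (!C d) = onePremise d !C

Step-map : ∀ {S S'} → S ⊆ S' → Step S ⊆ Step S'
Step-map S⊆S' st = Premises.rebuild (premises st) (All.map S⊆S' (Premises.hold (premises st)))

StarL-map : ∀ {S S'} → S ⊆ S' → StarL S ⊆ StarL S'
StarL-map S⊆S' (⋆Lω ps) = ⋆Lω (S⊆S' ∘ ps)

module _ {H : List Sequent} (P : SeqSet)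
         (onHyp : ∀ {s} → s ∈ H → P s) (onStep : ∀ {s} → Good s → Step P s → P s) where
  DerivFrom-fold : ∀ {s} → DerivFrom H s → P s
  Step-fold : ∀ {s} → Step (DerivFrom H) s → Step P s

  DerivFrom-fold (hyp s∈H) = onHyp s∈H
  DerivFrom-fold (step g st) = onStep g (Step-fold st)

  Step-fold ax = ax
  Step-fold oneR = oneR
  Step-fold zeroL = zeroL
  Step-fold starAx = starAx
  Step-fold (＼L d₁ d₂) = ＼L (DerivFrom-fold d₁) (DerivFrom-fold d₂)
  Step-fold (＼R d) = ＼R (DerivFrom-fold d)
  Step-fold (／L d₁ d₂) = ／L (DerivFrom-fold d₁) (DerivFrom-fold d₂)
  Step-fold (／R d) = ／R (DerivFrom-fold d)
  Step-fold (·L d) = ·L (DerivFrom-fold d)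
  Step-fold (·R d₁ d₂) = ·R (DerivFrom-fold d₁) (DerivFrom-fold d₂)
  Step-fold (1L d) = 1L (DerivFrom-fold d)
  Step-fold (⊕L d₁ d₂) = ⊕L (DerivFrom-fold d₁) (DerivFrom-fold d₂)
  Step-fold (⊕R₁ d) = ⊕R₁ (DerivFrom-fold d)
  Step-fold (⊕R₂ d) = ⊕R₂ (DerivFrom-fold d)
  Step-fold (&L₁ d) = &L₁ (DerivFrom-fold d)
  Step-fold (&L₂ d) = &L₂ (DerivFrom-fold d)
  Step-fold (&R d₁ d₂) = &R (DerivFrom-fold d₁) (DerivFrom-fold d₂)
  Step-fold (⋆R Π Πs ds) = ⋆R Π Πs (λ Π'∈ → DerivFrom-fold (ds Π'∈))
  Step-fold (!L d) = !L (DerivFrom-fold d)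
  Step-fold (!R Π d) = !R Π (DerivFrom-fold d)
  Step-fold (!P₁ d) = !P₁ (DerivFrom-fold d)
  Step-fold (!P₂ d) = !P₂ (DerivFrom-fold d)
  Step-fold (!W d) = !W (DerivFrom-fold d)
  Step-fold (!C d) = !C (DerivFrom-fold d)

μ-frame : ∀ Γ {Ys Xs} Δ C → (∀ e → starsCtx Ys e ≤ starsCtx Xs e) →
          Γ ++ Ys ++ Δ ⇒ C ≤μ Γ ++ Xs ++ Δ ⇒ C
μ-frame Γ Δ C Ys≤Xs e = starsCtx-frame (C ∷ Γ) Δ e (Ys≤Xs e)

μ-↭ : ∀ {Γ Γ'} C → Γ ↭ Γ' → Γ ⇒ C ≤μ Γ' ⇒ C
μ-↭ C Γ↭Γ' e = ≤-reflexive (starsCtx-↭ (prep C Γ↭Γ') e)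

implicationL-≤μ : ∀ Γ Π Δ {A B X C} → (∀ e → stars X e ≡ stars B e + stars A e) →
                  All (_≤μ Γ ++ X ∷ Π ++ Δ ⇒ C) ((Π ⇒ A) ∷ (Γ ++ B ∷ Δ ⇒ C) ∷ [])
implicationL-≤μ Γ Π Δ {A} {B} {X} {C} X≡B+A = left ∷ right ∷ []
  where
  A≤X : ∀ e → stars A e ≤ stars X e
  A≤X e = subst (_ ≤_) (sym (X≡B+A e)) (m≤n+m _ _)
  B≤X : ∀ e → stars B e ≤ stars X e
  B≤X e = subst (_ ≤_) (sym (X≡B+A e)) (m≤m+n _ _)
  left : Π ⇒ A ≤μ Γ ++ X ∷ Π ++ Δ ⇒ C
  left e = ≤-trans (+-monoˡ-≤ _ (A≤X e)) (starsCtx-infix (C ∷ Γ) (X ∷ Π) Δ e)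
  right : Γ ++ B ∷ Δ ⇒ C ≤μ Γ ++ X ∷ Π ++ Δ ⇒ C
  right = μ-frame Γ Δ C (λ e → +-mono-≤ (B≤X e) z≤n)

implicationR-≤μ : ∀ Π {A B X} → (∀ e → stars X e ≡ stars B e + stars A e) →
                  A ∷ Π ⇒ B ≤μ Π ⇒ X
implicationR-≤μ Π {A} {B} X≡B+A e =
  ≤-reflexive (trans (sym (+-assoc (stars B e) _ _)) (cong (_+ starsCtx Π e) (sym (X≡B+A e))))

succedent-≤μ : ∀ Π {A B} → (∀ e → stars A e ≤ stars B e) → Π ⇒ A ≤μ Π ⇒ B
succedent-≤μ Π A≤B e = +-monoˡ-≤ (starsCtx Π e) (A≤B e)

premises-≤μ : ∀ {R s} → Good s → (st : Step R s) → All (_≤μ s) (Premises.list (premises st))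
premises-≤μ _ ax = []
premises-≤μ _ oneR = []
premises-≤μ _ zeroL = []
premises-≤μ _ starAx = []
premises-≤μ _ (＼L {Π} {Γ} {Δ} {A} {B} {C} _ _) =
  All.map (λ p≤ e → ≤-trans (p≤ e) (μ-↭ C (++⁺ˡ Γ (↭-sym (shift (A ＼ B) Π Δ))) e))
          (implicationL-≤μ Γ Π Δ (λ _ → refl))
premises-≤μ _ (／L {Π} {Γ} {Δ} _ _) = implicationL-≤μ Γ Π Δ (λ _ → refl)
premises-≤μ _ (＼R {Π} {A} {B} _) = implicationR-≤μ Π {A} {B} {A ＼ B} (λ _ → refl) ∷ []
premises-≤μ _ (／R {Π} {A} {B} _) =
  (λ e → ≤-trans (μ-↭ B (↭-sym (∷↭∷ʳ A Π)) e) (implicationR-≤μ Π {A} {B} {B ／ A} (λ _ → refl) e))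
  ∷ []
premises-≤μ _ (·L {Γ} {Δ} {A} {B} {C} _) =
  μ-frame Γ Δ C (λ e → ≤-reflexive (sym (+-assoc (stars A e) (stars B e) 0))) ∷ []
premises-≤μ _ (·R {Γ} {Δ} {A} {B} _ _) =
  (λ e → +-mono-≤ (m≤m+n (stars A e) (stars B e)) (starsCtx-infix [] Γ Δ e)) ∷
  (λ e → +-mono-≤ (m≤n+m (stars B e) (stars A e))
                  (subst (_ ≤_) (sym (starsCtx-++ Γ Δ e)) (m≤n+m _ _))) ∷ []
premises-≤μ _ (1L {Γ} {Δ} {C} _) = μ-frame Γ Δ C (λ _ → z≤n) ∷ []
premises-≤μ _ (⊕L {Γ} {Δ} {C = C} _ _) =
  μ-frame Γ Δ C (λ _ → +-monoˡ-≤ 0 (m≤m+n _ _)) ∷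
  μ-frame Γ Δ C (λ _ → +-monoˡ-≤ 0 (m≤n+m _ _)) ∷ []
premises-≤μ _ (⊕R₁ {Π} {A₁} {A₂} _) =
  succedent-≤μ Π {A₁} {A₁ ⊕ A₂} (λ e → m≤m+n (stars A₁ e) (stars A₂ e)) ∷ []
premises-≤μ _ (⊕R₂ {Π} {A₁} {A₂} _) =
  succedent-≤μ Π {A₂} {A₁ ⊕ A₂} (λ e → m≤n+m (stars A₂ e) (stars A₁ e)) ∷ []
premises-≤μ _ (&L₁ {Γ} {Δ} {C = C} _) = μ-frame Γ Δ C (λ _ → +-monoˡ-≤ 0 (m≤m+n _ _)) ∷ []
premises-≤μ _ (&L₂ {Γ} {Δ} {C = C} _) = μ-frame Γ Δ C (λ _ → +-monoˡ-≤ 0 (m≤n+m _ _)) ∷ []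
premises-≤μ _ (&R {Π} {A₁} {A₂} _ _) =
  succedent-≤μ Π {A₁} {A₁ & A₂} (λ e → m≤m+n (stars A₁ e) (stars A₂ e)) ∷
  succedent-≤μ Π {A₂} {A₁ & A₂} (λ e → m≤n+m (stars A₂ e) (stars A₁ e)) ∷ []
premises-≤μ _ (⋆R Π Πs _) =
  All.map⁺ (All.tabulate (λ Π'∈ e → +-mono-≤ (m≤n+m _ _) (starsCtx-concat (Π ∷ Πs) e Π'∈)))
premises-≤μ _ (!L {Γ} {Δ} {C = C} _) = μ-frame Γ Δ C (λ _ → ≤-refl) ∷ []
premises-≤μ _ (!R _ _) = (λ _ → ≤-refl) ∷ []
premises-≤μ _ (!P₁ {Γ} {Π} {Δ} {A} {C} _) = μ-↭ C (++⁺ˡ Γ (shift (! A) Π Δ)) ∷ []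
premises-≤μ _ (!P₂ {Γ} {Π} {Δ} {A} {C} _) = μ-↭ C (++⁺ˡ Γ (↭-sym (shift (! A) Π Δ))) ∷ []
premises-≤μ _ (!W {Γ} {Δ} {C = C} _) = μ-frame Γ Δ C (λ _ → z≤n) ∷ []
premises-≤μ (goodΓ , _) (!C {Γ} {Δ} {A} {C} _) = μ-frame Γ Δ C duplicate≤ ∷ []
  where
  duplicate≤ : ∀ e → stars A e + (stars A e + 0) ≤ stars A e + 0
  duplicate≤ e rewrite stars-StarFree A {e} (All.head (All.++⁻ʳ Γ goodΓ)) = z≤n

starL-premise-μ : ∀ Γ Δ A C n {e} → starHeight (A ⋆) ≤ e →
                  μ (Γ ++ A ⋆ ∷ Δ ⇒ C) e ≡
                  indicator (starHeight (A ⋆)) e + μ (Γ ++ replicate n A ++ Δ ⇒ C) e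
starL-premise-μ Γ Δ A C n {e} h≤e = begin
  μ (Γ ++ A ⋆ ∷ Δ ⇒ C) e                   ≡⟨ starsCtx-middle (C ∷ Γ) [ A ⋆ ] Δ e ⟩
  (δ + stars A e) + 0 + rest               ≡⟨ cong (λ x → (δ + x) + 0 + rest) sA≡0 ⟩
  (δ + 0) + 0 + rest                       ≡⟨ cong (_+ rest) (trans (+-identityʳ _) (+-identityʳ δ)) ⟩
  δ + rest                                 ≡⟨ cong (λ x → δ + (x + rest)) (starsCtx-replicate n sA≡0) ⟨
  δ + (starsCtx (replicate n A) e + rest)  ≡⟨ cong (δ +_) (starsCtx-middle (C ∷ Γ) (replicate n A) Δ e) ⟨
  δ + μ (Γ ++ replicate n A ++ Δ ⇒ C) e    ∎
  where
  open ≡-Reasoning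
  δ = indicator (starHeight (A ⋆)) e
  rest = starsCtx (C ∷ Γ ++ Δ) e
  sA≡0 = stars-above A h≤e

starL-premise-<μ : ∀ Γ Δ A C n → let h = starHeight (A ⋆) in
                   μ (Γ ++ replicate n A ++ Δ ⇒ C) h < μ (Γ ++ A ⋆ ∷ Δ ⇒ C) h
starL-premise-<μ Γ Δ A C n =
  ≤-reflexive (sym (trans (starL-premise-μ Γ Δ A C n ≤-refl) (cong (_+ μ premise h) (indicator-refl h))))
  where
  h = starHeight (A ⋆)
  premise = Γ ++ replicate n A ++ Δ ⇒ C

starL-premise-≤μ : ∀ Γ Δ A C n e → starHeight (A ⋆) < e →
                   μ (Γ ++ replicate n A ++ Δ ⇒ C) e ≤ μ (Γ ++ A ⋆ ∷ Δ ⇒ C) e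
starL-premise-≤μ Γ Δ A C n e h<e =
  ≤-reflexive (sym (trans (starL-premise-μ Γ Δ A C n (<⇒≤ h<e)) (cong (_+ μ premise e) (indicator-< h<e))))
  where premise = Γ ++ replicate n A ++ Δ ⇒ C

FinDerivable : SeqSet → SeqSet
FinDerivable X s = Σ (List Sequent) λ H → All X H × DerivFrom H s

DerivFrom-weaken : ∀ {H H'} → (∀ {h} → h ∈ H → h ∈ H') → DerivFrom H ⊆ DerivFrom H'
DerivFrom-weaken {H' = H'} H⊆H' = DerivFrom-fold (DerivFrom H') (λ h∈H → hyp (H⊆H' h∈H)) step

FinDerivable-map : ∀ {X Y} → X ⊆ Y → FinDerivable X ⊆ FinDerivable Y
FinDerivable-map X⊆Y (H , xs , d) = H , All.map X⊆Y xs , d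

Step⇒FinDerivable : ∀ {S s} → Good s → Step S s → FinDerivable S s
Step⇒FinDerivable g st = _ , Premises.hold (premises st) , step g (Premises.rebuild (premises st) (All.tabulate hyp))

FinDerivable-all : ∀ {X Ps} → All (FinDerivable X) Ps → Σ (List Sequent) λ H → All X H × All (DerivFrom H) Ps
FinDerivable-all [] = [] , [] , []
FinDerivable-all ((H₁ , xs₁ , d) ∷ rest) with FinDerivable-all rest
... | H₂ , xs₂ , ds =
  H₁ ++ H₂ , All.++⁺ xs₁ xs₂ , DerivFrom-weaken ∈-++⁺ˡ d ∷ All.map (DerivFrom-weaken (∈-++⁺ʳ H₁)) ds

FinDerivable-trans : ∀ {X H s} → (∀ {h} → h ∈ H → h ≤μ s → FinDerivable X h) →
                     ∀ {t} → DerivFrom H t → t ≤μ s → FinDerivable X t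
FinDerivable-trans {X} {H} {s} onHyp = DerivFrom-fold (λ t → t ≤μ s → FinDerivable X t) onHyp onStep
  where
  onStep : ∀ {t} → Good t → Step (λ u → u ≤μ s → FinDerivable X u) t → t ≤μ s → FinDerivable X t
  onStep g st t≤s with FinDerivable-all (All.zipWith (λ (f , u≤t) → f (λ e → ≤-trans (u≤t e) (t≤s e)))
                                                      (Premises.hold (premises st) , premises-≤μ g st))
  ... | H' , xs , ds = H' , xs , step g (Premises.rebuild (premises st) ds)

infixl 6 _+ℕ_
_+ℕ_ : Ord → ℕ → Ord
a +ℕ zero = a
a +ℕ suc k = os (a +ℕ k)

os-+ℕ : ∀ a k → os a +ℕ k ≡ a +ℕ suc k
os-+ℕ a zero = refl
os-+ℕ a (suc k) = cong os (os-+ℕ a k)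

iter+ℕ : (SeqSet → SeqSet) → Ord → SeqSet
iter+ℕ F a s = ∃ λ k → iter F (a +ℕ k) s

+ℕ≡+o : ∀ a k → a +ℕ k ≡ a +o ((ω^ 0) ×n k)
+ℕ≡+o a zero = refl
+ℕ≡+o a (suc k) = cong os (+ℕ≡+o a k)

-- cantor k m a = a + ω^k·m (k−1) + … + ω^1·m 0
cantor : ℕ → (ℕ → ℕ) → Ord → Ord
cantor zero m a = a
cantor (suc k) m a = cantor k m (a +o ((ω^ suc k) ×n m k))

cantor-ext : ∀ {D D'} m a → (∀ e → D ≤ e → m e ≡ 0) → D ≤′ D' → cantor D' m a ≡ cantor D m a
cantor-ext m a m≡0 ≤′-refl = refl
cantor-ext m a m≡0 (≤′-step {k} D≤′k) rewrite m≡0 k (≤′⇒≤ D≤′k) = cantor-ext m a m≡0 D≤′k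

rank : Sequent → Ord
rank s = cantor (heightBound s) (μ s) oz

rank-at : ∀ s {D} → heightBound s ≤ D → rank s ≡ cantor D (μ s) oz
rank-at s hb≤D = sym (cantor-ext (μ s) oz (λ _ → μ-above s) (≤⇒≤′ hb≤D))

module Stages (F : SeqSet → SeqSet) (F-mono : ∀ {S S'} → S ⊆ S' → F S ⊆ F S')
              (F-inflationary : ∀ {S} → S ⊆ F S) where

  infix 4 _⊑_
  _⊑_ : Ord → Ord → Set
  a ⊑ b = iter F a ⊆ iter F b

  ≡⇒⊑ : ∀ {a b} → a ≡ b → a ⊑ b
  ≡⇒⊑ refl = id

  +o-monoˡ-⊑ : ∀ {a b} x → a ⊑ b → a +o x ⊑ b +o x
  +o-monoˡ-⊑ oz a⊑b = a⊑b
  +o-monoˡ-⊑ {a} {b} (os x) a⊑b = F-mono (+o-monoˡ-⊑ {a} {b} x a⊑b)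
  +o-monoˡ-⊑ {a} {b} (olim f) a⊑b (n , y) = n , +o-monoˡ-⊑ {a} {b} (f n) a⊑b y

  ⊑-+o : ∀ a x → a ⊑ a +o x
  ⊑-+o a oz = id
  ⊑-+o a (os x) = F-inflationary ∘ ⊑-+o a x
  ⊑-+o a (olim f) y = 0 , ⊑-+o a (f 0) y

  +o-assoc-⊑ : ∀ a b c → (a +o b) +o c ⊑ a +o (b +o c)
  +o-assoc-⊑ a b oz = id
  +o-assoc-⊑ a b (os c) = F-mono (+o-assoc-⊑ a b c)
  +o-assoc-⊑ a b (olim f) (n , y) = n , +o-assoc-⊑ a b (f n) y

  ×n-mono-⊑ : ∀ a x {j k} → j ≤′ k → a +o (x ×n j) ⊑ a +o (x ×n k)
  ×n-mono-⊑ a x ≤′-refl = id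
  ×n-mono-⊑ a x (≤′-step {k} j≤′k) =
    +o-assoc-⊑ a (x ×n k) x ∘ ⊑-+o (a +o (x ×n k)) x ∘ ×n-mono-⊑ a x j≤′k

  +ℕ-mono-⊑ : ∀ a {j k} → j ≤′ k → a +ℕ j ⊑ a +ℕ k
  +ℕ-mono-⊑ a ≤′-refl = id
  +ℕ-mono-⊑ a (≤′-step j≤′k) = F-inflationary ∘ +ℕ-mono-⊑ a j≤′k

  common-+ℕ : ∀ a {Ps} → All (iter+ℕ F a) Ps → ∃ λ K → All (iter F (a +ℕ K)) Ps
  common-+ℕ a [] = 0 , []
  common-+ℕ a ((k , y) ∷ ys) with common-+ℕ a ys
  ... | K , ys' =
    k ⊔ K , +ℕ-mono-⊑ a (≤⇒≤′ (m≤m⊔n k K)) y ∷ All.map (+ℕ-mono-⊑ a (≤⇒≤′ (m≤n⊔m k K))) ys'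

  cantor-monoˡ-⊑ : ∀ k m a b → a ⊑ b → cantor k m a ⊑ cantor k m b
  cantor-monoˡ-⊑ zero m a b = id
  cantor-monoˡ-⊑ (suc k) m a b = cantor-monoˡ-⊑ k m _ _ ∘ +o-monoˡ-⊑ {a} {b} ((ω^ suc k) ×n m k)

  ⊑-cantor : ∀ k m a → a ⊑ cantor k m a
  ⊑-cantor zero m a = id
  ⊑-cantor (suc k) m a = ⊑-cantor k m (a +o x) ∘ ⊑-+o a x
    where x = (ω^ suc k) ×n m k

  cantor-monoʳ-⊑ : ∀ k {m m'} → (∀ e → m e ≤ m' e) → ∀ a → cantor k m a ⊑ cantor k m' a
  cantor-monoʳ-⊑ zero _ a = id
  cantor-monoʳ-⊑ (suc k) {m} m≤m' a =
    cantor-monoʳ-⊑ k m≤m' _ ∘ cantor-monoˡ-⊑ k m _ _ (×n-mono-⊑ a (ω^ suc k) (≤⇒≤′ (m≤m' k)))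

  cantor-+ℕ-⊑ : ∀ k m a j → cantor k m a +ℕ j ⊑ a +o (ω^ suc k)
  cantor-+ℕ-⊑ zero m a j y = j , ≡⇒⊑ (+ℕ≡+o a j) y
  cantor-+ℕ-⊑ (suc k) m a j y = suc (m k) , +o-assoc-⊑ a (W ×n m k) W (cantor-+ℕ-⊑ k m _ j y)
    where W = ω^ suc k

  cantor-lex-⊑ : ∀ D {m' m d} a → d < D → m' d < m d → (∀ e → d < e → m' e ≤ m e) →
                 ∀ j → cantor D m' a +ℕ j ⊑ cantor D m a
  cantor-lex-⊑ (suc k) {m'} {m} a d<D m'd<md above j with m≤n⇒m<n∨m≡n (≤-pred d<D)
  ... | inj₂ refl =
    ⊑-cantor k m _ ∘ ×n-mono-⊑ a W (≤⇒≤′ m'd<md) ∘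
    +o-assoc-⊑ a (W ×n m' k) W ∘ cantor-+ℕ-⊑ k m' _ j
    where W = ω^ suc k
  ... | inj₁ d<k =
    cantor-monoˡ-⊑ k m _ _ (×n-mono-⊑ a (ω^ suc k) (≤⇒≤′ (above k d<k))) ∘
    cantor-lex-⊑ k _ d<k m'd<md above j

  rank-mono-⊑ : ∀ {t s} → t ≤μ s → rank t ⊑ rank s
  rank-mono-⊑ {t} {s} t≤s =
    ≡⇒⊑ (sym (rank-at s (m≤n⊔m (heightBound t) _))) ∘
    cantor-monoʳ-⊑ D t≤s oz ∘
    ≡⇒⊑ (rank-at t (m≤m⊔n _ (heightBound s)))
    where D = heightBound t ⊔ heightBound s

  rank-lex-⊑ : ∀ {t s} d → μ t d < μ s d → (∀ e → d < e → μ t e ≤ μ s e) →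
               ∀ j → rank t +ℕ j ⊑ rank s
  rank-lex-⊑ {t} {s} d μtd<μsd above j =
    ≡⇒⊑ (sym (rank-at s (m≤n⊔m (heightBound t) _))) ∘
    cantor-lex-⊑ D oz (<-≤-trans d<hb (m≤n⊔m (heightBound t) _)) μtd<μsd above j ∘
    ≡⇒⊑ (cong (_+ℕ j) (rank-at t (m≤m⊔n _ (heightBound s))))
    where
    D = heightBound t ⊔ heightBound s
    d<hb : d < heightBound s
    d<hb = ≰⇒> λ hb≤d → n≮0 (subst (μ t d <_) (μ-above s hb≤d) μtd<μsd)

  -- oz +o ω^(D+1) is the first term of the fundamental sequence of ω^(D+2).
  rank-+ℕ-⊑-ω^ω : ∀ s j → rank s +ℕ j ⊑ ω^ω
  rank-+ℕ-⊑-ω^ω s j y = suc (suc (heightBound s)) , 1 , cantor-+ℕ-⊑ (heightBound s) (μ s) oz j y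

  rank-starL-premise-⊑ : ∀ Γ Δ A C n j →
                         rank (Γ ++ replicate n A ++ Δ ⇒ C) +ℕ j ⊑ rank (Γ ++ A ⋆ ∷ Δ ⇒ C)
  rank-starL-premise-⊑ Γ Δ A C n =
    rank-lex-⊑ {Γ ++ replicate n A ++ Δ ⇒ C} {Γ ++ A ⋆ ∷ Δ ⇒ C} _
               (starL-premise-<μ Γ Δ A C n) (starL-premise-≤μ Γ Δ A C n)

record IsDerivabilityOperator (F : SeqSet → SeqSet) : Set₁ where
  field
    mono         : ∀ {S S'} → S ⊆ S' → F S ⊆ F S'
    inflationary : ∀ {S} → S ⊆ F S
    cases        : ∀ {S} → F S ⊆ S ∪ (Good ∩ (StarL S ∪ FinDerivable S))
    starL        : ∀ {S} → Good ∩ StarL S ⊆ F S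
    finite       : ∀ {a H} → All (iter F a) H → DerivFrom H ⊆ iter+ℕ F a

module _ {F} (isOp : IsDerivabilityOperator F) where
  open IsDerivabilityOperator isOp
  open Stages F mono inflationary

  FinDerivable⇒stage : ∀ {a} → FinDerivable (iter F (os a)) ⊆ iter+ℕ F a
  FinDerivable⇒stage {a} (H , hs , d) with finite hs d
  ... | k , y = suc k , ≡⇒⊑ (os-+ℕ a k) y

  iter⇒FinDerivable : ∀ α {s} → iter F α s → FinDerivable (iter F (os (rank s))) s
  iter⇒FinDerivable oz ()
  iter⇒FinDerivable (olim f) (n , y) = iter⇒FinDerivable (f n) y
  iter⇒FinDerivable (os α) {s} y with cases y
  ... | inj₁ y' = iter⇒FinDerivable α y'
  ... | inj₂ (_ , inj₂ (H , hs , d)) = FinDerivable-trans {s = s} below-s d (λ _ → ≤-refl)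
    where
    below-s : ∀ {h} → h ∈ H → h ≤μ s → FinDerivable (iter F (os (rank s))) h
    below-s {h} h∈H h≤s =
      FinDerivable-map (mono (rank-mono-⊑ {h} {s} h≤s)) (iter⇒FinDerivable α (All.lookup hs h∈H))
  ... | inj₂ (g , inj₁ (⋆Lω {Γ} {Δ} {A} {C} ps)) =
    [ s ] , starL (g , ⋆Lω premises-below) ∷ [] , hyp (here refl)
    where
    premises-below : ∀ n → iter F (rank (Γ ++ A ⋆ ∷ Δ ⇒ C)) (Γ ++ replicate n A ++ Δ ⇒ C)
    premises-below n with FinDerivable⇒stage (iter⇒FinDerivable α (ps n))
    ... | k , y = rank-starL-premise-⊑ Γ Δ A C n k y

  closureOrdinal≤ω^ω : ClosureOrdinal≤ F ω^ω
  closureOrdinal≤ω^ω = stabilises , λ _ → inflationary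
    where
    stabilises : ∀ s → iter F (os ω^ω) s → iter F ω^ω s
    stabilises s y with FinDerivable⇒stage (iter⇒FinDerivable (os ω^ω) y)
    ... | k , y' = rank-+ℕ-⊑-ω^ω s k y'

𝒟̲⁻-isDerivabilityOperator : IsDerivabilityOperator 𝒟̲⁻
𝒟̲⁻-isDerivabilityOperator = record
  { mono         = mono
  ; inflationary = inj₁
  ; cases        = id
  ; starL        = λ (g , st) → inj₂ (g , inj₁ st)
  ; finite       = finite
  }
  where
  mono : ∀ {S S'} → S ⊆ S' → 𝒟̲⁻ S ⊆ 𝒟̲⁻ S'
  mono S⊆S' (inj₁ y) = inj₁ (S⊆S' y)
  mono S⊆S' (inj₂ (g , inj₁ st)) = inj₂ (g , inj₁ (StarL-map S⊆S' st))
  mono S⊆S' (inj₂ (g , inj₂ (H , hs , d))) = inj₂ (g , inj₂ (H , All.map S⊆S' hs , d))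
  finite : ∀ {a H} → All (iter 𝒟̲⁻ a) H → DerivFrom H ⊆ iter+ℕ 𝒟̲⁻ a
  finite hs (hyp s∈H) = 1 , inj₁ (All.lookup hs s∈H)
  finite hs d@(step g _) = 1 , inj₂ (g , inj₂ (_ , hs , d))

𝒟⁻-isDerivabilityOperator : IsDerivabilityOperator 𝒟⁻
𝒟⁻-isDerivabilityOperator = record
  { mono         = mono
  ; inflationary = inj₁
  ; cases        = cases
  ; starL        = λ (g , st) → inj₂ (g , inj₂ st)
  ; finite       = finite
  }
  where
  mono : ∀ {S S'} → S ⊆ S' → 𝒟⁻ S ⊆ 𝒟⁻ S'
  mono S⊆S' (inj₁ y) = inj₁ (S⊆S' y)
  mono S⊆S' (inj₂ (g , inj₁ st)) = inj₂ (g , inj₁ (Step-map S⊆S' st))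
  mono S⊆S' (inj₂ (g , inj₂ st)) = inj₂ (g , inj₂ (StarL-map S⊆S' st))
  cases : ∀ {S} → 𝒟⁻ S ⊆ S ∪ (Good ∩ (StarL S ∪ FinDerivable S))
  cases (inj₁ y) = inj₁ y
  cases (inj₂ (g , inj₁ st)) = inj₂ (g , inj₂ (Step⇒FinDerivable g st))
  cases (inj₂ (g , inj₂ st)) = inj₂ (g , inj₁ st)
  open Stages 𝒟⁻ mono inj₁ using (common-+ℕ)
  finite : ∀ {a H} → All (iter 𝒟⁻ a) H → DerivFrom H ⊆ iter+ℕ 𝒟⁻ a
  finite {a} hs = DerivFrom-fold _ (λ s∈H → 0 , All.lookup hs s∈H) onStep
    where
    onStep : ∀ {s} → Good s → Step (iter+ℕ 𝒟⁻ a) s → iter+ℕ 𝒟⁻ a s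
    onStep g st with common-+ℕ a (Premises.hold (premises st))
    ... | K , ys = suc K , inj₂ (g , inj₁ (Premises.rebuild (premises st) ys))

theorem5p2 : ClosureOrdinal≤ 𝒟̲⁻ ω^ω × ClosureOrdinal≤ 𝒟⁻ ω^ω
theorem5p2 =
  closureOrdinal≤ω^ω 𝒟̲⁻-isDerivabilityOperator , closureOrdinal≤ω^ω 𝒟⁻-isDerivabilityOperator
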